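{- Let \(G\) be a finite simple graph and let \(H\) be a spanning subgraph of \(G\) (obtained from \(G\) by deleting some edges but no vertices). Then \(\operatorname{pf}(G)\ge \operatorname{pf}(H)\).
   Context: For a finite simple graph \(G\) on \(2n\) vertices, assign an independent variable \(x_e\) to each edge \(e\); the perfect-matching polynomial is \(\mathrm{PM}(G)=\sum_{M}\prod_{e\in M}x_e\) over all perfect matchings \(M\). Fix an ordering of the vertices. For an orientation \(D\) of \(G\), the weighted skew-adjacency matrix \(A_D\) has \((A_D)_{ij}=x_{ij}\) if \(ij\) is an edge oriented from \(i\) to \(j\), \(-x_{ij}\) if oriented from \(j\) to \(i\), and \(0\) if \(ij\) is not an edge; \(\mathrm{Pf}(A_D)\) is its Pfaffian. \(G\) is \(k\)-Pfaffian if there exist orientations \(D_1,\dots,D_k\) and reals \(c_1,\dots,c_k\) with \(\mathrm{PM}(G)=\sum_{i=1}^k c_i\,\mathrm{Pf}(A_{D_i})\) as polynomials; the Pfaffian number \(\operatorname{pf}(G)\) is the least positive integer \(k\) such that \(G\) is \(k\)-Pfaffian. -}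

module Defs where

open import Level using (Level; _⊔_)
open import Algebra.Bundles using (CommutativeRing)
open import Data.Bool using (Bool; true; false; if_then_else_; not; _∧_)
open import Data.Nat using (ℕ; zero; suc; _≤_; _<ᵇ_)
import Data.Nat.Properties as ℕP
import Data.Nat as ℕ
open import Data.Fin using (Fin; zero; suc; toℕ; punchIn; _≟_)
open import Data.Vec using (Vec; tabulate; zipWith)
open import Data.Vec.Properties using (≡-dec)
open import Data.List using (List; []; _∷_; _++_; map; concatMap; foldr; filter)
open import Data.Product using (Σ; Σ-syntax; _×_; _,_)
open import Relation.Binary.PropositionalEquality using (_≡_)
open import Relation.Nullary using (does)
open import Relation.Nullary.Decidable using (T?)
open import Data.Bool using (T)

record SimpleGraph (m : ℕ) : Set where
  field
    adj    : Fin m → Fin m → Bool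
    sym    : ∀ i j → adj i j ≡ adj j i
    irrefl : ∀ i → adj i i ≡ false
open SimpleGraph public

SpanningSubgraph : ∀ {m} → SimpleGraph m → SimpleGraph m → Set
SpanningSubgraph {m} H G = ∀ (i j : Fin m) → adj H i j ≡ true → adj G i j ≡ true

-- An orientation of G: every edge ij gets exactly one direction
-- (dir i j ≡ true means the edge is oriented from i to j).
record Orientation {m} (G : SimpleGraph m) : Set where
  field
    dir  : Fin m → Fin m → Bool
    anti : ∀ i j → adj G i j ≡ true → dir j i ≡ not (dir i j)
open Orientation public

-- Polynomials with coefficients in a commutative ring R, in the
-- variables x_{ij} (i , j : Fin m; the edge variable x_e for e = {i,j}
-- is x_{min i j , max i j}).  A polynomial is a formal finite sum of
-- terms (coefficient , monomial); a monomial is an exponent matrix.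

module Poly {c ℓ : Level} (R : CommutativeRing c ℓ) (m : ℕ) where
  open CommutativeRing R using (Carrier; _≈_; _+_; _*_; -_; 0#; 1#)

  Mono : Set
  Mono = Vec (Vec ℕ m) m

  _≟M_ : (μ ν : Mono) → Bool
  μ ≟M ν = does (≡-dec (≡-dec ℕP._≟_) μ ν)

  _⊕_ : Mono → Mono → Mono
  μ ⊕ ν = zipWith (zipWith ℕ._+_) μ ν

  oneM : Mono
  oneM = tabulate λ _ → tabulate λ _ → 0

  Term : Set c
  Term = Carrier × Mono

  Polynomial : Set c
  Polynomial = List Term

  0P : Polynomial
  0P = []

  1P : Polynomial
  1P = (1# , oneM) ∷ []

  _+P_ : Polynomial → Polynomial → Polynomial
  p +P q = p ++ q

  -P_ : Polynomial → Polynomial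
  -P p = map (λ { (a , μ) → (- a , μ) }) p

  _*P_ : Polynomial → Polynomial → Polynomial
  p *P q = concatMap (λ { (a , μ) → map (λ { (b , ν) → (a * b , μ ⊕ ν) }) q }) p

  _·P_ : Carrier → Polynomial → Polynomial
  r ·P p = map (λ { (a , μ) → (r * a , μ) }) p

  coeff : Polynomial → Mono → Carrier
  coeff p μ = foldr (λ { (a , ν) acc → if ν ≟M μ then a + acc else acc }) 0# p

  _≈P_ : Polynomial → Polynomial → Set ℓ
  p ≈P q = ∀ μ → coeff p μ ≈ coeff q μ

  var : Fin m → Fin m → Polynomial
  var i j = (1# , tabulate (λ r → tabulate (λ s →
              if does (r ≟ lo) ∧ does (s ≟ hi) then 1 else 0))) ∷ []
    where
      lo hi : Fin m
      lo = if toℕ j <ᵇ toℕ i then j else i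
      hi = if toℕ j <ᵇ toℕ i then i else j

  sumF : (k : ℕ) → (Fin k → Polynomial) → Polynomial
  sumF zero    f = 0P
  sumF (suc k) f = f zero +P sumF k (λ i → f (suc i))

  prodF : (k : ℕ) → (Fin k → Polynomial) → Polynomial
  prodF zero    f = 1P
  prodF (suc k) f = f zero *P prodF k (λ i → f (suc i))

  alt : ℕ → Polynomial → Polynomial
  alt zero    p = p
  alt (suc n) p = -P (alt n p)

  Pf : (k : ℕ) → (Fin k → Fin k → Polynomial) → Polynomial
  Pf zero          A = 1P
  Pf (suc zero)    A = 0P
  Pf (suc (suc k)) A =
    sumF (suc k) (λ j → alt (toℕ j)
      (A zero (suc j) *P Pf k (λ r s → A (suc (punchIn j r)) (suc (punchIn j s)))))

  skewAdj : {G : SimpleGraph m} → Orientation G → Fin m → Fin m → Polynomial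
  skewAdj {G} D i j =
    if adj G i j then (if dir D i j then var i j else -P var i j) else 0P

  allFuns : (k : ℕ) → List (Fin k → Fin m)
  allFuns zero    = (λ ()) ∷ []
  allFuns (suc k) = concatMap (λ f → map (λ a → λ { zero → a ; (suc i) → f i })
                                          (allElems m)) (allFuns k)
    where
      allElems : (n : ℕ) → List (Fin n)
      allElems zero    = []
      allElems (suc n) = zero ∷ map suc (allElems n)

  allB : (k : ℕ) → (Fin k → Bool) → Bool
  allB zero    f = true
  allB (suc k) f = f zero ∧ allB k (λ i → f (suc i))

  -- A perfect matching of G is encoded by its partner map π:
  -- every vertex i is matched to π i via an edge of G, and π is an
  -- involution (so each vertex lies in exactly one matching edge).
  isPerfectMatching : SimpleGraph m → (Fin m → Fin m) → Bool
  isPerfectMatching G π =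
    allB m (λ i → adj G i (π i) ∧ does (π (π i) ≟ i))

  -- the monomial ∏_{e ∈ M} x_e (each edge {i, π i} counted once, at i < π i)
  matchingMonomial : (Fin m → Fin m) → Polynomial
  matchingMonomial π =
    prodF m (λ i → if toℕ i <ᵇ toℕ (π i) then var i (π i) else 1P)

  PM : SimpleGraph m → Polynomial
  PM G = foldr (λ π acc → matchingMonomial π +P acc) 0P
               (filter (λ π → T? (isPerfectMatching G π)) (allFuns m))

  KPfaffian : SimpleGraph m → ℕ → Set (c ⊔ ℓ)
  KPfaffian G k =
    Σ[ D ∈ (Fin k → Orientation G) ] Σ[ cs ∈ (Fin k → Carrier) ]
      (PM G ≈P sumF k (λ i → cs i ·P Pf m (skewAdj (D i))))

  IsPfaffianNumber : SimpleGraph m → ℕ → Set (c ⊔ ℓ)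
  IsPfaffianNumber G k =
    (1 ≤ k) × KPfaffian G k × (∀ j → 1 ≤ j → KPfaffian G j → k ≤ j)

{-# OPTIONS --safe #-}
module Submission where

-- Substituting x_e := 0 for the edges e of G outside H is a ring homomorphism. It maps
-- PM(G) to PM(H), because a perfect matching of G survives exactly when all of its edges
-- lie in H, and it maps Pf(A_D) to Pf(A_D′), where D′ is D restricted to the edges of H.
-- Hence every k-Pfaffian representation of G yields one of H, and pf(H) ≤ pf(G) by the
-- minimality of pf(H). On the term-list representation of polynomials the substitution
-- deletes the terms whose monomial involves a variable outside H. It commutes with the
-- polynomial operations exactly, and it acts on each coefficient either as the identity
-- or as 0, so it respects equality of polynomials.

open import Algebra.Bundles using (CommutativeRing)
open import Data.Bool using (Bool; true; false; if_then_else_; _∧_; _∨_)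
open import Data.Bool.Properties using (∨-distribʳ-∧; ∧-identityʳ; ∧-zeroʳ; T-≡)
open import Data.Empty using (⊥-elim)
open import Data.Fin using (Fin; zero; suc; toℕ; _≟_; punchIn)
open import Data.Fin.Properties using (toℕ-injective; suc-injective)
open import Data.List using (List; []; _∷_; map; foldr; filterᵇ; [_])
open import Data.List.Properties using (filter-++; concatMap-++)
open import Data.Nat using (ℕ; zero; suc; _+_; _≤_; _<_; _<ᵇ_; _≡ᵇ_)
import Data.Nat.Properties as ℕ
open import Data.Product using (Σ-syntax; _×_; _,_; proj₁; proj₂)
open import Data.Vec using (lookup; tabulate; zipWith)
open import Data.Vec.Properties using (lookup-zipWith; lookup∘tabulate; ≡-dec)
open import Defs hiding (sym)
open import Function.Bundles using (Equivalence)
open import Level using (Level)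
open import Relation.Binary.Definitions using (tri<; tri≈; tri>)
open import Relation.Binary.PropositionalEquality
  using (_≡_; _≢_; refl; sym; trans; cong; cong₂; subst; subst₂; module ≡-Reasoning)
open import Relation.Nullary using (does; yes; no)
open import Relation.Nullary.Decidable using (dec-true; dec-false)

module _ {c ℓ : Level} (R : CommutativeRing c ℓ) (m : ℕ) where
  open Poly R m
  open CommutativeRing R using (Carrier; _≈_; _*_; 0#) renaming (_+_ to _+R_; refl to ≈-refl)

  ∧-true⇒ : ∀ {a b} → a ∧ b ≡ true → a ≡ true × b ≡ true
  ∧-true⇒ {true} {true} refl = refl , refl

  allB-cong : ∀ k {f g : Fin k → Bool} → (∀ i → f i ≡ g i) → allB k f ≡ allB k g
  allB-cong zero    _ = refl
  allB-cong (suc k) e = cong₂ _∧_ (e zero) (allB-cong k (λ i → e (suc i)))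

  allB-∧ : ∀ k (f g : Fin k → Bool) → allB k (λ i → f i ∧ g i) ≡ allB k f ∧ allB k g
  allB-∧ zero    f g = refl
  allB-∧ (suc k) f g with f zero | g zero
  ... | true  | true  = allB-∧ k (λ i → f (suc i)) (λ i → g (suc i))
  ... | true  | false = sym (∧-zeroʳ _)
  ... | false | _     = refl

  allB-intro : ∀ k {f : Fin k → Bool} → (∀ i → f i ≡ true) → allB k f ≡ true
  allB-intro zero    _ = refl
  allB-intro (suc k) h = cong₂ _∧_ (h zero) (allB-intro k (λ i → h (suc i)))

  allB-elim : ∀ k {f : Fin k → Bool} → allB k f ≡ true → ∀ i → f i ≡ true
  allB-elim (suc k) h zero    = proj₁ (∧-true⇒ h)
  allB-elim (suc k) h (suc i) = allB-elim k (proj₂ (∧-true⇒ h)) i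

  allB-witness : ∀ k {f : Fin k → Bool} → allB k f ≡ false → Σ[ i ∈ Fin k ] f i ≡ false
  allB-witness (suc k) {f} h with f zero in f0
  ... | false = zero , f0
  ... | true  = let i , fi = allB-witness k h in suc i , fi

  allB-point : ∀ k {f : Fin k → Bool} a → (∀ i → i ≢ a → f i ≡ true) → allB k f ≡ f a
  allB-point (suc k) {f} zero    h =
    trans (cong (f zero ∧_) (allB-intro k (λ i → h (suc i) (λ ())))) (∧-identityʳ (f zero))
  allB-point (suc k)     (suc a) h rewrite h zero (λ ()) =
    allB-point k a (λ i i≢a → h (suc i) (λ si≡sa → i≢a (suc-injective si≡sa)))

  *P-zeroʳ : ∀ p → p *P [] ≡ []
  *P-zeroʳ []      = refl
  *P-zeroʳ (_ ∷ p) = *P-zeroʳ p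

  *P-distribʳ-+P : ∀ p p′ q → (p +P p′) *P q ≡ (p *P q) +P (p′ *P q)
  *P-distribʳ-+P p p′ q = concatMap-++ _ p p′

  prodF-zero : ∀ k {F : Fin k → Polynomial} i → F i ≡ [] → prodF k F ≡ []
  prodF-zero (suc k) {F} zero    Fi≡[] = cong (_*P prodF k (λ i → F (suc i))) Fi≡[]
  prodF-zero (suc k) {F} (suc i) Fi≡[] =
    trans (cong (F zero *P_) (prodF-zero k i Fi≡[])) (*P-zeroʳ (F zero))

  module Restriction (keep : Mono → Bool) where

    restrict : Polynomial → Polynomial
    restrict = filterᵇ (λ t → keep (proj₂ t))

    restrict-singleton : ∀ t → restrict [ t ] ≡ (if keep (proj₂ t) then [ t ] else [])
    restrict-singleton t with keep (proj₂ t)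
    ... | true  = refl
    ... | false = refl

    restrict-map : ∀ (f : Term → Term) → (∀ t → proj₂ (f t) ≡ proj₂ t) →
                   ∀ p → restrict (map f p) ≡ map f (restrict p)
    restrict-map f f-mono []      = refl
    restrict-map f f-mono (t ∷ p) rewrite f-mono t with keep (proj₂ t)
    ... | true  = cong (f t ∷_) (restrict-map f f-mono p)
    ... | false = restrict-map f f-mono p

    restrict-neg : ∀ p → restrict (-P p) ≡ -P restrict p
    restrict-neg = restrict-map _ (λ _ → refl)

    restrict-·P : ∀ r p → restrict (r ·P p) ≡ r ·P restrict p
    restrict-·P r = restrict-map _ (λ _ → refl)

    restrict-+P : ∀ p q → restrict (p +P q) ≡ restrict p +P restrict q
    restrict-+P = filter-++ _

    restrict-alt : ∀ n p → restrict (alt n p) ≡ alt n (restrict p)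
    restrict-alt zero    p = refl
    restrict-alt (suc n) p = trans (restrict-neg (alt n p)) (cong -P_ (restrict-alt n p))

    restrict-sumF : ∀ k {F F′ : Fin k → Polynomial} → (∀ i → restrict (F i) ≡ F′ i) →
                    restrict (sumF k F) ≡ sumF k F′
    restrict-sumF zero        _ = refl
    restrict-sumF (suc k) {F} e =
      trans (restrict-+P (F zero) _) (cong₂ _+P_ (e zero) (restrict-sumF k (λ i → e (suc i))))

    ≟M-sound : ∀ ν μ → ν ≟M μ ≡ true → ν ≡ μ
    ≟M-sound ν μ _ with ≡-dec (≡-dec ℕ._≟_) ν μ
    ≟M-sound ν μ _  | yes ν≡μ = ν≡μ
    ≟M-sound ν μ () | no _

    coeff-restrict-kept : ∀ p {μ} → keep μ ≡ true → coeff (restrict p) μ ≡ coeff p μ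
    coeff-restrict-kept []            kμ = refl
    coeff-restrict-kept ((a , ν) ∷ p) {μ} kμ with keep ν in kν
    ... | true with ν ≟M μ
    ...   | true  = cong (a +R_) (coeff-restrict-kept p kμ)
    ...   | false = coeff-restrict-kept p kμ
    coeff-restrict-kept ((a , ν) ∷ p) {μ} kμ | false with ν ≟M μ in ν≟μ
    ...   | true  with refl ← ≟M-sound ν μ ν≟μ with () ← trans (sym kν) kμ
    ...   | false = coeff-restrict-kept p kμ

    coeff-restrict-dropped : ∀ p {μ} → keep μ ≡ false → coeff (restrict p) μ ≡ 0#
    coeff-restrict-dropped []            kμ = refl
    coeff-restrict-dropped ((a , ν) ∷ p) {μ} kμ with keep ν in kν
    ... | false = coeff-restrict-dropped p kμ
    ... | true with ν ≟M μ in ν≟μ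
    ...   | true  with refl ← ≟M-sound ν μ ν≟μ with () ← trans (sym kν) kμ
    ...   | false = coeff-restrict-dropped p kμ

    restrict-resp-≈P : ∀ p q → p ≈P q → restrict p ≈P restrict q
    restrict-resp-≈P p q p≈q μ with keep μ in kμ
    ... | true  = subst₂ _≈_ (sym (coeff-restrict-kept p kμ)) (sym (coeff-restrict-kept q kμ)) (p≈q μ)
    ... | false = subst₂ _≈_ (sym (coeff-restrict-dropped p kμ)) (sym (coeff-restrict-dropped q kμ)) ≈-refl

    module Multiplicative (keep-⊕ : ∀ μ ν → keep (μ ⊕ ν) ≡ keep μ ∧ keep ν)
                          (keep-oneM : keep oneM ≡ true) where

      restrict-singleton*P-kept : ∀ a μ q → keep μ ≡ true →
                                  restrict ([ (a , μ) ] *P q) ≡ [ (a , μ) ] *P restrict q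
      restrict-singleton*P-kept a μ []            kμ = refl
      restrict-singleton*P-kept a μ ((b , ν) ∷ q) kμ rewrite keep-⊕ μ ν | kμ with keep ν
      ... | true  = cong ((a * b , μ ⊕ ν) ∷_) (restrict-singleton*P-kept a μ q kμ)
      ... | false = restrict-singleton*P-kept a μ q kμ

      restrict-singleton*P-dropped : ∀ a μ q → keep μ ≡ false → restrict ([ (a , μ) ] *P q) ≡ []
      restrict-singleton*P-dropped a μ []            kμ = refl
      restrict-singleton*P-dropped a μ ((b , ν) ∷ q) kμ rewrite keep-⊕ μ ν | kμ =
        restrict-singleton*P-dropped a μ q kμ

      restrict-singleton*P : ∀ a μ q → restrict ([ (a , μ) ] *P q) ≡ restrict [ (a , μ) ] *P restrict q
      restrict-singleton*P a μ q with keep μ in kμ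
      ... | true  = restrict-singleton*P-kept a μ q kμ
      ... | false = restrict-singleton*P-dropped a μ q kμ

      restrict-*P : ∀ p q → restrict (p *P q) ≡ restrict p *P restrict q
      restrict-*P []      q = refl
      restrict-*P (t ∷ p) q = begin
        restrict (([ t ] +P p) *P q)                  ≡⟨ cong restrict (*P-distribʳ-+P [ t ] p q) ⟩
        restrict (([ t ] *P q) +P (p *P q))           ≡⟨ restrict-+P ([ t ] *P q) (p *P q) ⟩
        restrict ([ t ] *P q) +P restrict (p *P q)    ≡⟨ cong₂ _+P_ (restrict-singleton*P _ _ q)
                                                                      (restrict-*P p q) ⟩
        (restrict [ t ] *P restrict q) +P (restrict p *P restrict q)
          ≡⟨ sym (*P-distribʳ-+P (restrict [ t ]) (restrict p) (restrict q)) ⟩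
        (restrict [ t ] +P restrict p) *P restrict q  ≡⟨ cong (_*P restrict q) (sym (restrict-+P [ t ] p)) ⟩
        restrict ([ t ] +P p) *P restrict q           ∎
        where open ≡-Reasoning

      restrict-1P : restrict 1P ≡ 1P
      restrict-1P rewrite keep-oneM = refl

      restrict-prodF : ∀ k {F F′ : Fin k → Polynomial} → (∀ i → restrict (F i) ≡ F′ i) →
                       restrict (prodF k F) ≡ prodF k F′
      restrict-prodF zero        _ = restrict-1P
      restrict-prodF (suc k) {F} e =
        trans (restrict-*P (F zero) _) (cong₂ _*P_ (e zero) (restrict-prodF k (λ i → e (suc i))))

      restrict-Pf : ∀ k {A B : Fin k → Fin k → Polynomial} → (∀ i j → restrict (A i j) ≡ B i j) →
                    restrict (Pf k A) ≡ Pf k B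
      restrict-Pf zero          _ = restrict-1P
      restrict-Pf (suc zero)    _ = refl
      restrict-Pf (suc (suc k)) {A} {B} e =
        restrict-sumF (suc k) {λ j → laplaceTerm A j} {λ j → laplaceTerm B j} restrict-laplaceTerm
        where
          open ≡-Reasoning
          Matrix : Set c
          Matrix = Fin (suc (suc k)) → Fin (suc (suc k)) → Polynomial
          minor : Matrix → Fin (suc k) → Fin k → Fin k → Polynomial
          minor M j r s = M (suc (punchIn j r)) (suc (punchIn j s))
          laplaceTerm : Matrix → Fin (suc k) → Polynomial
          laplaceTerm M j = alt (toℕ j) (M zero (suc j) *P Pf k (minor M j))
          restrict-laplaceTerm : ∀ j → restrict (laplaceTerm A j) ≡ laplaceTerm B j
          restrict-laplaceTerm j = begin
            restrict (alt (toℕ j) (A zero (suc j) *P Pf k (minor A j)))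
              ≡⟨ restrict-alt (toℕ j) _ ⟩
            alt (toℕ j) (restrict (A zero (suc j) *P Pf k (minor A j)))
              ≡⟨ cong (alt (toℕ j)) (restrict-*P (A zero (suc j)) _) ⟩
            alt (toℕ j) (restrict (A zero (suc j)) *P restrict (Pf k (minor A j)))
              ≡⟨ cong (alt (toℕ j)) (cong₂ _*P_ (e zero (suc j))
                   (restrict-Pf k (λ r s → e (suc (punchIn j r)) (suc (punchIn j s))))) ⟩
            alt (toℕ j) (B zero (suc j) *P Pf k (minor B j)) ∎

  supportedIn : SimpleGraph m → Mono → Bool
  supportedIn H μ = allB m λ r → allB m λ s → (lookup (lookup μ r) s ≡ᵇ 0) ∨ adj H r s

  unitMono : Fin m → Fin m → Mono
  unitMono a b = tabulate λ r → tabulate λ s → if does (r ≟ a) ∧ does (s ≟ b) then 1 else 0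

  unitMono-entry : ∀ a b r s →
                   lookup (lookup (unitMono a b) r) s ≡ (if does (r ≟ a) ∧ does (s ≟ b) then 1 else 0)
  unitMono-entry a b r s
    rewrite lookup∘tabulate (λ r → tabulate λ s → if does (r ≟ a) ∧ does (s ≟ b) then 1 else 0) r =
    lookup∘tabulate (λ s → if does (r ≟ a) ∧ does (s ≟ b) then 1 else 0) s

  +-≡ᵇ0 : ∀ a b → (a + b ≡ᵇ 0) ≡ (a ≡ᵇ 0) ∧ (b ≡ᵇ 0)
  +-≡ᵇ0 zero    b = refl
  +-≡ᵇ0 (suc a) b = refl

  module Supported (H : SimpleGraph m) where

    supportedIn-⊕ : ∀ μ ν → supportedIn H (μ ⊕ ν) ≡ supportedIn H μ ∧ supportedIn H ν
    supportedIn-⊕ μ ν =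
      trans (allB-cong m λ r → trans (allB-cong m (entry r)) (allB-∧ m _ _)) (allB-∧ m _ _)
      where
        entry : ∀ r s → (lookup (lookup (μ ⊕ ν) r) s ≡ᵇ 0) ∨ adj H r s
                      ≡ ((lookup (lookup μ r) s ≡ᵇ 0) ∨ adj H r s)
                        ∧ ((lookup (lookup ν r) s ≡ᵇ 0) ∨ adj H r s)
        entry r s rewrite lookup-zipWith (zipWith _+_) r μ ν
                        | lookup-zipWith _+_ s (lookup μ r) (lookup ν r)
                        | +-≡ᵇ0 (lookup (lookup μ r) s) (lookup (lookup ν r) s) =
          ∨-distribʳ-∧ (adj H r s) (lookup (lookup μ r) s ≡ᵇ 0) (lookup (lookup ν r) s ≡ᵇ 0)

    supportedIn-oneM : supportedIn H oneM ≡ true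
    supportedIn-oneM = allB-intro m λ r → allB-intro m λ s → entry r s
      where
        entry : ∀ r s → (lookup (lookup oneM r) s ≡ᵇ 0) ∨ adj H r s ≡ true
        entry r s rewrite lookup∘tabulate (λ _ → tabulate (λ (_ : Fin m) → 0)) r
                        | lookup∘tabulate (λ (_ : Fin m) → 0) s = refl

    supportedIn-unitMono : ∀ a b → supportedIn H (unitMono a b) ≡ adj H a b
    supportedIn-unitMono a b =
      trans (allB-point m a off-row) (trans (allB-point m b off-column) at-ab)
      where
        entry : Fin m → Fin m → Bool
        entry r s = (lookup (lookup (unitMono a b) r) s ≡ᵇ 0) ∨ adj H r s
        off-row-entry : ∀ r → r ≢ a → ∀ s → entry r s ≡ true
        off-row-entry r r≢a s rewrite unitMono-entry a b r s | dec-false (r ≟ a) r≢a = refl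
        off-row : ∀ r → r ≢ a → allB m (entry r) ≡ true
        off-row r r≢a = allB-intro m (off-row-entry r r≢a)
        off-column : ∀ s → s ≢ b → entry a s ≡ true
        off-column s s≢b
          rewrite unitMono-entry a b a s | dec-true (a ≟ a) refl | dec-false (s ≟ b) s≢b = refl
        at-ab : entry a b ≡ adj H a b
        at-ab rewrite unitMono-entry a b a b | dec-true (a ≟ a) refl | dec-true (b ≟ b) refl = refl

    open Restriction (supportedIn H) public
    open Multiplicative supportedIn-⊕ supportedIn-oneM public

    restrict-var : ∀ {i j b} → adj H i j ≡ b → restrict (var i j) ≡ (if b then var i j else [])
    restrict-var {i} {j} refl = trans (restrict-singleton _) (cong (λ b → if b then var i j else [])
      (trans (supportedIn-unitMono (if toℕ j <ᵇ toℕ i then j else i) (if toℕ j <ᵇ toℕ i then i else j))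
             (adj-sorted (toℕ j <ᵇ toℕ i))))
      where
        adj-sorted : ∀ b → adj H (if b then j else i) (if b then i else j) ≡ adj H i j
        adj-sorted true  = SimpleGraph.sym H j i
        adj-sorted false = refl

  perfectMatching-at : ∀ {X π} → isPerfectMatching X π ≡ true →
                       ∀ i → adj X i (π i) ≡ true × does (π (π i) ≟ i) ≡ true
  perfectMatching-at pm i = ∧-true⇒ (allB-elim m pm i)

  perfectMatching-involutive : ∀ {X π} → isPerfectMatching X π ≡ true → ∀ i → π (π i) ≡ i
  perfectMatching-involutive {X} {π} pm i with π (π i) ≟ i | proj₂ (perfectMatching-at {X} {π} pm i)
  ... | yes ππi≡i | _  = ππi≡i
  ... | no _      | ()

  perfectMatching-fixedPointFree : ∀ {X π} → isPerfectMatching X π ≡ true → ∀ i → i ≢ π i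
  perfectMatching-fixedPointFree {X} {π} pm i i≡πi
    with () ← trans (sym (irrefl X i))
                    (subst (λ k → adj X i k ≡ true) (sym i≡πi) (proj₁ (perfectMatching-at {X} {π} pm i)))

  perfectMatching-missingEdge : ∀ {X Y π} → isPerfectMatching X π ≡ true → isPerfectMatching Y π ≡ false →
                                Σ[ i ∈ Fin m ] adj Y i (π i) ≡ false
  perfectMatching-missingEdge {X} {Y} {π} pmX ¬pmY with (i , ¬pmY-i) ← allB-witness m ¬pmY =
    i , trans (sym (∧-identityʳ (adj Y i (π i))))
              (subst (λ b → adj Y i (π i) ∧ b ≡ false)
                     (dec-true (π (π i) ≟ i) (perfectMatching-involutive {X} {π} pmX i)) ¬pmY-i)

  matchedPair-lowerEnd : ∀ (π : Fin m → Fin m) (P : Fin m → Fin m → Set) → (∀ {a b} → P a b → P b a) →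
                         ∀ i → π (π i) ≡ i → i ≢ π i → P i (π i) →
                         Σ[ j ∈ Fin m ] toℕ j < toℕ (π j) × P j (π j)
  matchedPair-lowerEnd π P P-sym i ππi≡i i≢πi Pi with ℕ.<-cmp (toℕ i) (toℕ (π i))
  ... | tri< i<πi _ _ = i , i<πi , Pi
  ... | tri≈ _ i≡πi _ = ⊥-elim (i≢πi (toℕ-injective i≡πi))
  ... | tri> _ _ πi<i = π i , subst (λ k → toℕ (π i) < toℕ k) (sym ππi≡i) πi<i
                            , subst (P (π i)) (sym ππi≡i) (P-sym Pi)

  matchingFactor : (Fin m → Fin m) → Fin m → Polynomial
  matchingFactor π i = if toℕ i <ᵇ toℕ (π i) then var i (π i) else 1P

  sumMatchings : List (Fin m → Fin m) → Polynomial
  sumMatchings = foldr (λ π acc → matchingMonomial π +P acc) 0P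

  pfaffianCombination : ∀ {X : SimpleGraph m} {k} → (Fin k → Orientation X) → (Fin k → Carrier) → Polynomial
  pfaffianCombination {k = k} D cs = sumF k λ i → cs i ·P Pf m (skewAdj (D i))

  module _ (H : SimpleGraph m) where
    open Supported H

    restrict-matchingMonomial-kept : ∀ {π} → isPerfectMatching H π ≡ true →
                                     restrict (matchingMonomial π) ≡ matchingMonomial π
    restrict-matchingMonomial-kept {π} pm = restrict-prodF m {matchingFactor π} restrict-factor
      where
        restrict-factor : ∀ i → restrict (matchingFactor π i) ≡ matchingFactor π i
        restrict-factor i with toℕ i <ᵇ toℕ (π i)
        ... | true  = restrict-var (proj₁ (perfectMatching-at {H} {π} pm i))
        ... | false = restrict-1P

    restrict-matchingFactor-missing : ∀ {π j} → toℕ j < toℕ (π j) → adj H j (π j) ≡ false →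
                                      restrict (matchingFactor π j) ≡ []
    restrict-matchingFactor-missing j<πj j∉H rewrite Equivalence.to T-≡ (ℕ.<⇒<ᵇ j<πj) = restrict-var j∉H

    restrict-matchingMonomial-dropped : ∀ {X π} → isPerfectMatching X π ≡ true →
                                        isPerfectMatching H π ≡ false →
                                        restrict (matchingMonomial π) ≡ []
    restrict-matchingMonomial-dropped {X} {π} pmX ¬pmH
      with (i , i∉H) ← perfectMatching-missingEdge {X} {H} {π} pmX ¬pmH
      with (j , j<πj , j∉H) ← matchedPair-lowerEnd π (λ a b → adj H a b ≡ false)
                                 (λ {a} {b} → trans (SimpleGraph.sym H b a)) i
                                 (perfectMatching-involutive {X} {π} pmX i)
                                 (perfectMatching-fixedPointFree {X} {π} pmX i) i∉H =
      trans (restrict-prodF m {matchingFactor π} (λ _ → refl))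
            (prodF-zero m j (restrict-matchingFactor-missing {π} j<πj j∉H))

  module _ {G H : SimpleGraph m} (H⊆G : SpanningSubgraph H G) where
    open Supported H

    restrictOrientation : Orientation G → Orientation H
    restrictOrientation D = record { dir = dir D ; anti = λ i j ij∈H → anti D i j (H⊆G i j ij∈H) }

    restrict-skewAdj : ∀ D i j → restrict (skewAdj D i j) ≡ skewAdj (restrictOrientation D) i j
    restrict-skewAdj D i j with adj G i j in ij∈G | adj H i j in ij∈H | dir D i j
    ... | false | false | _     = refl
    ... | false | true  | _     with () ← trans (sym ij∈G) (H⊆G i j ij∈H)
    ... | true  | _     | true  = restrict-var ij∈H
    ... | true  | true  | false = trans (restrict-neg (var i j)) (cong -P_ (restrict-var ij∈H))
    ... | true  | false | false = trans (restrict-neg (var i j)) (cong -P_ (restrict-var ij∈H))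

    perfectMatching-mono : ∀ {π} → isPerfectMatching H π ≡ true → isPerfectMatching G π ≡ true
    perfectMatching-mono {π} pm = allB-intro m λ i →
      let i-πi∈H , ππi≡i = perfectMatching-at {H} {π} pm i in cong₂ _∧_ (H⊆G i (π i) i-πi∈H) ππi≡i

    restrict-PM : restrict (PM G) ≡ PM H
    restrict-PM = restrict-sumMatchings (allFuns m)
      where
        restrict-sumMatchings : ∀ πs → restrict (sumMatchings (filterᵇ (isPerfectMatching G) πs))
                                       ≡ sumMatchings (filterᵇ (isPerfectMatching H) πs)
        restrict-sumMatchings []       = refl
        restrict-sumMatchings (π ∷ πs) with isPerfectMatching G π in pmG | isPerfectMatching H π in pmH
        ... | true  | true  = trans (restrict-+P (matchingMonomial π) _)
                                    (cong₂ _+P_ (restrict-matchingMonomial-kept H pmH)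
                                                (restrict-sumMatchings πs))
        ... | true  | false = trans (restrict-+P (matchingMonomial π) _)
                                    (cong₂ _+P_ (restrict-matchingMonomial-dropped H {G} pmG pmH)
                                                (restrict-sumMatchings πs))
        ... | false | true  with () ← trans (sym pmG) (perfectMatching-mono pmH)
        ... | false | false = restrict-sumMatchings πs

    restrict-pfaffianCombination : ∀ {k} (D : Fin k → Orientation G) cs →
      restrict (pfaffianCombination D cs) ≡ pfaffianCombination (λ i → restrictOrientation (D i)) cs
    restrict-pfaffianCombination {k} D cs = restrict-sumF k λ i →
      trans (restrict-·P (cs i) (Pf m (skewAdj (D i))))
            (cong (cs i ·P_) (restrict-Pf m {skewAdj (D i)} (restrict-skewAdj (D i))))

    KPfaffian-spanningSubgraph : ∀ {k} → KPfaffian G k → KPfaffian H k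
    KPfaffian-spanningSubgraph (D , cs , PM≈) =
      (λ i → restrictOrientation (D i)) , cs ,
      subst₂ _≈P_ restrict-PM (restrict-pfaffianCombination D cs)
             (restrict-resp-≈P (PM G) (pfaffianCombination D cs) PM≈)

lemma2p3 : ∀ {c ℓ : Level} (R : CommutativeRing c ℓ) (n : ℕ)
             (G H : SimpleGraph (n + n)) → SpanningSubgraph H G →
             (kG kH : ℕ) →
             Poly.IsPfaffianNumber R (n + n) G kG →
             Poly.IsPfaffianNumber R (n + n) H kH →
             kH ≤ kG
lemma2p3 R n G H H⊆G kG kH (1≤kG , G-kG-Pfaffian , _) (_ , _ , kH-least) =
  kH-least kG 1≤kG (KPfaffian-spanningSubgraph R (n + n) H⊆G G-kG-Pfaffian)
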